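{- Let $n\geq 2$ and let $G$ be the rook's graph $K_2\square K_n$. Then $\tau(G)=0$.
   Context: The rook's graph $K_m\square K_n$ has vertex set $\{v_{r,c}: 1\le r\le m, 1\le c\le n\}$, with $v_{r,c}\sim v_{r',c'}$ iff exactly one of $r=r'$, $c=c'$ holds. A triangulation of $G=(V,E)$ is a chordal graph $H$ on $V$ with $E\subseteq E_H$; it is minimum if $|E_H|$ is smallest possible. $\mathrm{tw}$ denotes treewidth. $\tau(G):=\min\{\mathrm{tw}(H): H \text{ a minimum triangulation of } G\}-\mathrm{tw}(G)$. -}

module Defs where

open import Data.Nat using (ℕ; zero; suc; _+_; _*_; _≤_; _<ᵇ_; NonZero)
open import Data.Nat.DivMod using (_mod_)
open import Data.Bool using (Bool; true; false; _∧_; _xor_; if_then_else_)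
open import Data.Fin using (Fin; toℕ; remQuot; _≟_)
open import Data.Fin.Subset using (Subset; ∣_∣) renaming (_∈_ to _∈ₛ_)
open import Data.List using (List; []; _∷_; _++_; map; allFin)
open import Data.Nat.ListAction using (sum)
open import Data.List.Relation.Unary.All using (All)
open import Data.List.Relation.Unary.Linked using (Linked)
open import Data.Product using (Σ; ∃; ∃-syntax; _×_; _,_; proj₁; proj₂)
open import Data.Sum using (_⊎_)
open import Data.Empty using (⊥)
open import Function.Definitions using (Injective)
open import Relation.Nullary using (¬_; yes; no)
open import Relation.Nullary.Decidable using (⌊_⌋)
open import Relation.Binary.PropositionalEquality using (_≡_; _≢_; refl; sym)

record Graph (n : ℕ) : Set where
  field
    adj    : Fin n → Fin n → Bool
    symm   : ∀ i j → adj i j ≡ adj j i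
    irrefl : ∀ i → adj i i ≡ false

open Graph public

E : ∀ {n} → Graph n → Fin n → Fin n → Set
E G i j = adj G i j ≡ true

edgeCount : ∀ {n} → Graph n → ℕ
edgeCount {n} G =
  sum (map (λ i → sum (map (λ j → if (toℕ i <ᵇ toℕ j) ∧ adj G i j then 1 else 0)
                            (allFin n)))
           (allFin n))

next : ∀ {m} → Fin (suc m) → Fin (suc m)
next {m} i = suc (toℕ i) mod suc m

-- a cycle of length (suc m) in G: distinct vertices c 0, …, c m with
-- c i ~ c (i+1 mod (suc m))
IsCycle : ∀ {n} → Graph n → (m : ℕ) → (Fin (suc m) → Fin n) → Set
IsCycle G m c = Injective _≡_ _≡_ c × (∀ i → E G (c i) (c (next i)))

HasChord : ∀ {n} → Graph n → (m : ℕ) → (Fin (suc m) → Fin n) → Set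
HasChord G m c = ∃[ i ] ∃[ j ] (j ≢ next i × i ≢ next j × E G (c i) (c j))

Chordal : ∀ {n} → Graph n → Set
Chordal G = ∀ m (c : Fin (suc m) → Fin _) → 3 ≤ m → IsCycle G m c → HasChord G m c

ConnectedOn : ∀ {n} → Graph n → (Fin n → Set) → Set
ConnectedOn G P = ∀ u v → P u → P v →
  (u ≡ v) ⊎ (∃[ ys ] (Linked (E G) (u ∷ ys ++ v ∷ []) × All P ys))

Connected : ∀ {n} → Graph n → Set
Connected G = ConnectedOn G (λ _ → Data.Unit.⊤)
  where import Data.Unit

Acyclic : ∀ {n} → Graph n → Set
Acyclic G = ∀ m c → 2 ≤ m → ¬ IsCycle G m c

IsTree : ∀ {n} → Graph n → Set
IsTree T = Connected T × Acyclic T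

record TreeDecomposition {n} (G : Graph n) : Set where
  field
    t        : ℕ
    T        : Graph (suc t)
    isTree   : IsTree T
    bag      : Fin (suc t) → Subset n
    covers   : ∀ v → ∃[ x ] (v ∈ₛ bag x)
    edgeIn   : ∀ u v → E G u v → ∃[ x ] (u ∈ₛ bag x × v ∈ₛ bag x)
    subtree  : ∀ v → ConnectedOn T (λ x → v ∈ₛ bag x)

open TreeDecomposition public

WidthAtMost : ∀ {n} {G : Graph n} → TreeDecomposition G → ℕ → Set
WidthAtMost D w = ∀ x → ∣ bag D x ∣ ≤ suc w

IsTreewidth : ∀ {n} → Graph n → ℕ → Set
IsTreewidth G k =
  (∃[ D ] WidthAtMost {G = G} D k) ×
  (∀ w (D : TreeDecomposition G) → WidthAtMost D w → k ≤ w)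

Subgraph : ∀ {n} → Graph n → Graph n → Set
Subgraph G H = ∀ i j → E G i j → E H i j

IsTriangulation : ∀ {n} → Graph n → Graph n → Set
IsTriangulation G H = Chordal H × Subgraph G H

IsMinimumTriangulation : ∀ {n} → Graph n → Graph n → Set
IsMinimumTriangulation G H =
  IsTriangulation G H × (∀ H′ → IsTriangulation G H′ → edgeCount H ≤ edgeCount H′)

IsMinTriangTw : ∀ {n} → Graph n → ℕ → Set
IsMinTriangTw G s =
  (∃[ H ] (IsMinimumTriangulation G H × IsTreewidth H s)) ×
  (∀ H s′ → IsMinimumTriangulation G H → IsTreewidth H s′ → s ≤ s′)

-- τ(G) = d  (note min tw(H) ≥ tw(G) always, so d ∈ ℕ)
HasTau : ∀ {n} → Graph n → ℕ → Set
HasTau G d = ∃[ t ] ∃[ s ] (IsTreewidth G t × IsMinTriangTw G s × s ≡ d + t)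

-- Rook's graph K_m □ K_n on Fin (m * n); vertex i ↔ (r, c) = remQuot n i

eqᵇ : ∀ {k} → Fin k → Fin k → Bool
eqᵇ a b = ⌊ a ≟ b ⌋

eqᵇ-refl : ∀ {k} (a : Fin k) → eqᵇ a a ≡ true
eqᵇ-refl a with a ≟ a
... | yes _ = refl
... | no ¬p = Data.Empty.⊥-elim (¬p refl)
  where import Data.Empty

eqᵇ-sym : ∀ {k} (a b : Fin k) → eqᵇ a b ≡ eqᵇ b a
eqᵇ-sym a b with a ≟ b | b ≟ a
... | yes _ | yes _ = refl
... | no _  | no _  = refl
... | yes p | no ¬q = Data.Empty.⊥-elim (¬q (sym p))
  where import Data.Empty
... | no ¬p | yes q = Data.Empty.⊥-elim (¬p (sym q))
  where import Data.Empty

rookAdj : ∀ m n → Fin (m * n) → Fin (m * n) → Bool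
rookAdj m n i j =
  eqᵇ (proj₁ (remQuot {m} n i)) (proj₁ (remQuot {m} n j))
  xor eqᵇ (proj₂ (remQuot {m} n i)) (proj₂ (remQuot {m} n j))

Rook : (m n : ℕ) → Graph (m * n)
Rook m n = record
  { adj    = rookAdj m n
  ; symm   = λ i j → Relation.Binary.PropositionalEquality.cong₂ _xor_
                        (eqᵇ-sym (proj₁ (remQuot {m} n i)) (proj₁ (remQuot {m} n j)))
                        (eqᵇ-sym (proj₂ (remQuot {m} n i)) (proj₂ (remQuot {m} n j)))
  ; irrefl = λ i → irr i
  }
  where
  import Relation.Binary.PropositionalEquality
  irr : ∀ i → rookAdj m n i i ≡ false
  irr i rewrite eqᵇ-refl (proj₁ (remQuot {m} n i))
              | eqᵇ-refl (proj₂ (remQuot {m} n i)) = refl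

-- Let H be G together with the staircase edges v₁,c v₂,d for d < c. Eliminating v₁,₀, …, v₁,ₙ₋₁
-- and then the clique on row 2 is a perfect elimination ordering, so H is chordal, and the bags
-- {v₁,c | j ≤ c} ∪ {v₂,d | d ≤ j} (0 ≤ j < n) along a path form a tree decomposition of H of
-- width n. Every 4-cycle v₁,c v₁,d v₂,d v₂,c of G forces a diagonal in any triangulation, and H
-- adds exactly one diagonal for each pair c ≠ d, so H is a minimum triangulation. Conversely
-- tw(G) ≥ n: in a tree decomposition of G, the bags meeting row 1 and, for each d, the bags
-- containing v₂,d form n + 1 pairwise intersecting subtrees, so by the Helly property one bag
-- holds all of row 2 and a vertex of row 1. Hence tw(G) = tw(H) = n, and no triangulation of G
-- has treewidth below tw(G).

module Submission where

open import Defs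
open import Data.Bool using (Bool; true; false; _∧_; _∨_; _xor_; not; if_then_else_) renaming (T to Tᵇ)
open import Data.Bool.Properties using (∨-comm)
open import Data.Empty using (⊥; ⊥-elim)
open import Data.Fin using (Fin; zero; suc; toℕ; fromℕ; fromℕ<; inject₁; remQuot; combine; _↑ˡ_; _↑ʳ_; _≟_)
open import Data.Fin.Properties using (toℕ-injective; toℕ<n; toℕ-fromℕ; toℕ-fromℕ<; toℕ-inject₁; toℕ-↑ˡ; toℕ-↑ʳ; toℕ≤pred[n]; pigeonhole; any?; all?; ¬∀⟶∃¬; remQuot-combine; combine-remQuot)
open import Data.Fin.Subset using (Subset; ∣_∣) renaming (_∈_ to _∈ₛ_)
open import Data.Fin.Subset.Properties using (_∈?_)
open import Data.List using (List; []; _∷_; _++_; map; allFin)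
open import Data.List.Properties using (map-tabulate)
open import Data.List.Relation.Unary.All using (All; []; _∷_)
open import Data.List.Relation.Unary.Linked using (Linked; [-]; _∷_)
open import Data.Nat using (ℕ; zero; suc; _+_; _*_; _∸_; _≤_; _<_; z≤n; s≤s; z<s; _<ᵇ_; _≤?_)
  renaming (_≟_ to _≟ℕ_)
open import Data.Nat.DivMod using (_%_; m<n⇒m%n≡m; n%n≡0)
open import Data.Nat.ListAction using (sum)
open import Data.Nat.Properties hiding (_≟_)
open import Algebra.Properties.CommutativeSemigroup +-commutativeSemigroup using (interchange)
open import Algebra.Properties.CommutativeMonoid.Sum +-0-commutativeMonoid
  using (sum-cong-≗; sum-replicate-zero) renaming (sum to ∑)
open import Data.Product using (Σ; ∃-syntax; _×_; _,_; proj₁; proj₂; uncurry)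
open import Data.Sum using (_⊎_; inj₁; inj₂; [_,_])
open import Data.Unit using (⊤; tt)
open import Data.Vec using ([]; _∷_; lookup; tabulate)
open import Data.Vec.Properties using (lookup∘tabulate; []=⇒lookup; lookup⇒[]=)
open import Function using (_∘_)
open import Function.Definitions using (Injective)
open import Relation.Binary.Definitions using (tri<; tri≈; tri>)
open import Relation.Binary.PropositionalEquality using (_≡_; _≢_; refl; sym; trans; cong; cong₂; subst; subst₂; module ≡-Reasoning)
open import Relation.Nullary using (¬_; yes; no; Dec)
open import Relation.Nullary.Decidable using (⌊_⌋)

E-sym : ∀ {N} (K : Graph N) {x y} → E K x y → E K y x
E-sym K {x} {y} e = trans (symm K y x) e

E-irrefl : ∀ {N} (K : Graph N) {x} → ¬ E K x x
E-irrefl K {x} e with trans (sym e) (irrefl K x)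
... | ()

indicator : Bool → ℕ
indicator b = if b then 1 else 0

isYes-true : ∀ {P : Set} (P? : Dec P) → P → ⌊ P? ⌋ ≡ true
isYes-true (yes _) _ = refl
isYes-true (no ¬p) p = ⊥-elim (¬p p)

isYes-false : ∀ {P : Set} (P? : Dec P) → ¬ P → ⌊ P? ⌋ ≡ false
isYes-false (yes p) ¬p = ⊥-elim (¬p p)
isYes-false (no _) _ = refl

isYes-witness : ∀ {P : Set} (P? : Dec P) → ⌊ P? ⌋ ≡ true → P
isYes-witness (yes p) _ = p

least? : {P : ℕ → Set} → (∀ k → Dec (P k)) → ∀ n →
  (∃[ j ] (j < n × P j × (∀ i → i < j → ¬ P i))) ⊎ (∀ j → j < n → ¬ P j)
least? P? zero = inj₂ (λ _ ())
least? {P} P? (suc n) with least? P? n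
... | inj₁ (j , j<n , pj , below) = inj₁ (j , m<n⇒m<1+n j<n , pj , below)
... | inj₂ none with P? n
...   | yes pn = inj₁ (n , n<1+n n , pn , none)
...   | no ¬pn = inj₂ λ j j<1+n → [ none j , (λ { refl → ¬pn }) ] (m<1+n⇒m<n∨m≡n j<1+n)

<⇒∃+suc : ∀ {i j} → i < j → ∃[ m ] (j ≡ i + suc m)
<⇒∃+suc {zero} {suc j} _ = j , refl
<⇒∃+suc {suc i} {suc j} (s≤s i<j) with <⇒∃+suc i<j
... | m , eq = m , cong suc eq

argmin : ∀ {m} (g : Fin (suc m) → ℕ) → ∃[ k ] (∀ l → g k ≤ g l)
argmin {zero} g = zero , λ { zero → ≤-refl }
argmin {suc m} g with argmin (g ∘ suc)
... | k , min with g zero ≤? g (suc k)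
...   | yes g0≤ = zero , λ { zero → ≤-refl ; (suc l) → ≤-trans g0≤ (min l) }
...   | no g0≰ = suc k , λ { zero → <⇒≤ (≰⇒> g0≰) ; (suc l) → min l }

toℕ-next : ∀ {m} (k : Fin (suc m)) →
  (toℕ k < m × toℕ (next k) ≡ suc (toℕ k)) ⊎ (toℕ k ≡ m × toℕ (next k) ≡ 0)
toℕ-next {m} k with m≤n⇒m<n∨m≡n (toℕ≤pred[n] k)
... | inj₁ k<m = inj₁ (k<m , trans (toℕ-fromℕ< _) (m<n⇒m%n≡m (s≤s k<m)))
... | inj₂ k≡m = inj₂ (k≡m , trans (toℕ-fromℕ< _) (trans (cong (λ z → suc z % suc m) k≡m) (n%n≡0 (suc m))))

prev : ∀ {m} → Fin (suc m) → Fin (suc m)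
prev {m} zero = fromℕ m
prev (suc k) = inject₁ k

next-prev : ∀ {m} (k : Fin (suc m)) → next (prev k) ≡ k
next-prev {m} zero with toℕ-next (fromℕ m)
... | inj₁ (m<m , _) = ⊥-elim (<-irrefl (toℕ-fromℕ m) m<m)
... | inj₂ (_ , e) = toℕ-injective e
next-prev {m} (suc k) with toℕ-next (inject₁ k)
... | inj₁ (_ , e) = toℕ-injective (trans e (cong suc (toℕ-inject₁ k)))
... | inj₂ (k≡m , _) = ⊥-elim (<-irrefl (trans (sym (toℕ-inject₁ k)) k≡m) (toℕ<n k))

next≢id : ∀ {m} → 1 ≤ m → (k : Fin (suc m)) → next k ≢ k
next≢id {m} 1≤m k eq with toℕ-next k
... | inj₁ (_ , e) = 1+n≢n (trans (sym e) (cong toℕ eq))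
... | inj₂ (k≡m , e) = <⇒≢ 1≤m (sym (trans (sym k≡m) (trans (sym (cong toℕ eq)) e)))

next²≢id : ∀ {m} → 2 ≤ m → (k : Fin (suc m)) → next (next k) ≢ k
next²≢id {m} 2≤m k eq with toℕ-next k | toℕ-next (next k)
... | inj₁ (_ , e₁) | inj₁ (_ , e₂) = m≢1+n+m (toℕ k) (trans (sym (cong toℕ eq)) (trans e₂ (cong suc e₁)))
... | inj₁ (_ , e₁) | inj₂ (e₂ , e₃) = <⇒≢ 2≤m (trans (cong suc (sym k≡0)) (trans (sym e₁) e₂))
  where
  k≡0 : toℕ k ≡ 0
  k≡0 = trans (sym (cong toℕ eq)) e₃
... | inj₂ (k≡m , e₁) | inj₁ (_ , e₂) =
  <⇒≢ 2≤m (sym (trans (sym k≡m) (trans (sym (cong toℕ eq)) (trans e₂ (cong suc e₁)))))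
... | inj₂ (_ , e₁) | inj₂ (e₂ , _) = <⇒≢ (≤-trans (s≤s z≤n) 2≤m) (trans (sym e₁) e₂)

prev≢next² : ∀ {m} → 3 ≤ m → (k : Fin (suc m)) → prev k ≢ next (next k)
prev≢next² {m} 3≤m zero eq with toℕ-next {m} zero
... | inj₂ (0≡m , _) = <⇒≢ (≤-trans (s≤s z≤n) 3≤m) 0≡m
... | inj₁ (_ , e₁) with toℕ-next (next {m} zero)
...   | inj₁ (_ , e₂) = <⇒≢ 3≤m (sym (trans (sym (toℕ-fromℕ m)) (trans (cong toℕ eq) (trans e₂ (cong suc e₁)))))
...   | inj₂ (e₂ , _) = <⇒≢ (≤-trans (s≤s (s≤s z≤n)) 3≤m) (trans (sym e₁) e₂)
prev≢next² {m} 3≤m (suc k) eq with toℕ-next (suc k)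
... | inj₂ (e₁ , e₂) with toℕ-next (next (suc k))
...   | inj₁ (_ , e₃) =
  <⇒≢ 3≤m (sym (trans (sym e₁) (cong suc (trans (sym (toℕ-inject₁ k)) (trans (cong toℕ eq) (trans e₃ (cong suc e₂)))))))
...   | inj₂ (e₃ , _) = <⇒≢ (≤-trans (s≤s z≤n) 3≤m) (trans (sym e₂) e₃)
prev≢next² {m} 3≤m (suc k) eq | inj₁ (_ , e₁) with toℕ-next (next (suc k))
...   | inj₁ (_ , e₂) = m≢1+n+m (toℕ k) (trans (sym (toℕ-inject₁ k)) (trans (cong toℕ eq) (trans e₂ (cong suc e₁))))
...   | inj₂ (e₂ , e₃) = <⇒≢ 3≤m (sym (trans (sym e₂) (trans e₁ (cong (2 +_) k≡0))))
  where
  k≡0 : toℕ k ≡ 0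
  k≡0 = trans (sym (toℕ-inject₁ k)) (trans (cong toℕ eq) e₃)

-- Along a cycle, the vertex of least rank has adjacent neighbours, which are non-consecutive.
perfectElimination⇒chordal : ∀ {N} (K : Graph N) (rank : Fin N → ℕ) →
  (∀ {w u v} → E K w u → E K w v → rank w ≤ rank u → rank w ≤ rank v → u ≢ v → E K u v) →
  Chordal K
perfectElimination⇒chordal K rank simplicial m c 3≤m (injective , adjacent) with argmin (rank ∘ c)
... | k , least = prev k , next k , next≢next-prev , prev≢next² 3≤m k ,
                  simplicial {c k} edge-prev (adjacent k) (least (prev k)) (least (next k)) prev≢next
  where
  edge-prev : E K (c k) (c (prev k))
  edge-prev = E-sym K (subst (λ z → E K (c (prev k)) (c z)) (next-prev k) (adjacent (prev k)))
  next≢next-prev : next k ≢ next (prev k)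
  next≢next-prev eq = next≢id (≤-trans (s≤s z≤n) 3≤m) k (trans eq (next-prev k))
  prev≢next : c (prev k) ≢ c (next k)
  prev≢next eq = next²≢id (≤-trans (s≤s (s≤s z≤n)) 3≤m) k (sym (trans (sym (next-prev k)) (cong next (injective eq))))

isCycle-supergraph : ∀ {N} {G H : Graph N} {m f} → Subgraph G H → IsCycle G m f → IsCycle H m f
isCycle-supergraph G⊆H (injective , adjacent) = injective , λ i → G⊆H _ _ (adjacent i)

nonConsecutive-4-cycle : ∀ (i j : Fin 4) → j ≢ next i → i ≢ next j → j ≡ i ⊎ j ≡ next (next i)
nonConsecutive-4-cycle zero zero _ _ = inj₁ refl
nonConsecutive-4-cycle zero (suc zero) j≢i+1 _ = ⊥-elim (j≢i+1 refl)
nonConsecutive-4-cycle zero (suc (suc zero)) _ _ = inj₂ refl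
nonConsecutive-4-cycle zero (suc (suc (suc zero))) _ i≢j+1 = ⊥-elim (i≢j+1 refl)
nonConsecutive-4-cycle (suc zero) zero _ i≢j+1 = ⊥-elim (i≢j+1 refl)
nonConsecutive-4-cycle (suc zero) (suc zero) _ _ = inj₁ refl
nonConsecutive-4-cycle (suc zero) (suc (suc zero)) j≢i+1 _ = ⊥-elim (j≢i+1 refl)
nonConsecutive-4-cycle (suc zero) (suc (suc (suc zero))) _ _ = inj₂ refl
nonConsecutive-4-cycle (suc (suc zero)) zero _ _ = inj₂ refl
nonConsecutive-4-cycle (suc (suc zero)) (suc zero) _ i≢j+1 = ⊥-elim (i≢j+1 refl)
nonConsecutive-4-cycle (suc (suc zero)) (suc (suc zero)) _ _ = inj₁ refl
nonConsecutive-4-cycle (suc (suc zero)) (suc (suc (suc zero))) j≢i+1 _ = ⊥-elim (j≢i+1 refl)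
nonConsecutive-4-cycle (suc (suc (suc zero))) zero j≢i+1 _ = ⊥-elim (j≢i+1 refl)
nonConsecutive-4-cycle (suc (suc (suc zero))) (suc zero) _ _ = inj₂ refl
nonConsecutive-4-cycle (suc (suc (suc zero))) (suc (suc zero)) _ i≢j+1 = ⊥-elim (i≢j+1 refl)
nonConsecutive-4-cycle (suc (suc (suc zero))) (suc (suc (suc zero))) _ _ = inj₁ refl

∑-mono-≤ : ∀ {n} {f g : Fin n → ℕ} → (∀ i → f i ≤ g i) → ∑ f ≤ ∑ g
∑-mono-≤ {zero} _ = z≤n
∑-mono-≤ {suc n} f≤g = +-mono-≤ (f≤g zero) (∑-mono-≤ (f≤g ∘ suc))

∑-distrib-+ : ∀ {n} (f g : Fin n → ℕ) → ∑ (λ i → f i + g i) ≡ ∑ f + ∑ g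
∑-distrib-+ {zero} f g = refl
∑-distrib-+ {suc n} f g =
  trans (cong (f zero + g zero +_) (∑-distrib-+ (f ∘ suc) (g ∘ suc)))
        (interchange (f zero) (g zero) (∑ (f ∘ suc)) (∑ (g ∘ suc)))

∑-comm : ∀ {m n} (F : Fin m → Fin n → ℕ) → ∑ (λ i → ∑ (F i)) ≡ ∑ (λ j → ∑ (λ i → F i j))
∑-comm {zero} {n} F = sym (sum-replicate-zero n)
∑-comm {suc m} F = trans (cong (∑ (F zero) +_) (∑-comm (F ∘ suc)))
                         (sym (∑-distrib-+ (F zero) (λ j → ∑ (λ i → F (suc i) j))))

∑-++ : ∀ m n (f : Fin (m + n) → ℕ) → ∑ f ≡ ∑ (λ i → f (i ↑ˡ n)) + ∑ (λ j → f (m ↑ʳ j))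
∑-++ zero n f = refl
∑-++ (suc m) n f = trans (cong (f zero +_) (∑-++ m n (f ∘ suc))) (sym (+-assoc (f zero) _ _))

∑-ones : ∀ n → ∑ {n} (λ _ → 1) ≡ n
∑-ones zero = refl
∑-ones (suc n) = cong suc (∑-ones n)

term≤∑ : ∀ {n} (f : Fin n → ℕ) (i : Fin n) → f i ≤ ∑ f
term≤∑ f zero = m≤m+n _ _
term≤∑ f (suc i) = ≤-trans (term≤∑ (f ∘ suc) i) (m≤n+m _ (f zero))

sum-map-allFin : ∀ {n} (f : Fin n → ℕ) → sum (map f (allFin n)) ≡ ∑ f
sum-map-allFin {n} f = trans (cong sum (map-tabulate (λ i → i) f)) (sum-tabulate f)
  where
  sum-tabulate : ∀ {n} (h : Fin n → ℕ) → sum (Data.List.tabulate h) ≡ ∑ h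
  sum-tabulate {zero} h = refl
  sum-tabulate {suc n} h = cong (h zero +_) (sum-tabulate (h ∘ suc))

δ : ∀ {n} → Fin n → Fin n → ℕ
δ zero zero = 1
δ zero (suc _) = 0
δ (suc _) zero = 0
δ (suc a) (suc b) = δ a b

δ-refl : ∀ {n} (a : Fin n) → δ a a ≡ 1
δ-refl zero = refl
δ-refl (suc a) = δ-refl a

δ-≢ : ∀ {n} {a b : Fin n} → a ≢ b → δ a b ≡ 0
δ-≢ {a = zero} {zero} a≢b = ⊥-elim (a≢b refl)
δ-≢ {a = zero} {suc b} _ = refl
δ-≢ {a = suc a} {zero} _ = refl
δ-≢ {a = suc a} {suc b} a≢b = δ-≢ (a≢b ∘ cong suc)

∑-δ : ∀ {n} (b : Fin n) → ∑ (λ a → δ a b) ≡ 1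
∑-δ {suc n} zero = cong suc (sum-replicate-zero n)
∑-δ {suc n} (suc b) = ∑-δ b

indicator≤1 : ∀ b → indicator b ≤ 1
indicator≤1 true = ≤-refl
indicator≤1 false = z≤n

∣p∣≡∑ : ∀ {n} (p : Subset n) → ∣ p ∣ ≡ ∑ (indicator ∘ lookup p)
∣p∣≡∑ [] = refl
∣p∣≡∑ (true ∷ p) = cong suc (∣p∣≡∑ p)
∣p∣≡∑ (false ∷ p) = ∣p∣≡∑ p

∑∑ : ∀ {n} → (Fin n → Fin n → ℕ) → ℕ
∑∑ x = ∑ (λ c → ∑ (x c))

∑∑-symmetrise : ∀ {n} (x : Fin n → Fin n → ℕ) → ∑∑ (λ c d → x c d + x d c) ≡ ∑∑ x + ∑∑ x
∑∑-symmetrise x =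
  trans (sum-cong-≗ (λ c → ∑-distrib-+ (x c) (λ d → x d c)))
        (trans (∑-distrib-+ (λ c → ∑ (x c)) (λ c → ∑ (λ d → x d c)))
               (cong (∑∑ x +_) (∑-comm (λ c d → x d c))))

∑∑-≤-symmetrised : ∀ {n} (x y : Fin n → Fin n → ℕ) →
  (∀ c d → x c d + x d c ≤ y c d + y d c) → ∑∑ x ≤ ∑∑ y
∑∑-≤-symmetrised x y x≤y = halve (subst₂ _≤_ (∑∑-symmetrise x) (∑∑-symmetrise y)
                                              (∑-mono-≤ (λ c → ∑-mono-≤ (x≤y c))))
  where
  halve : ∀ {a b} → a + a ≤ b + b → a ≤ b
  halve {a} {b} a+a≤b+b with a ≤? b
  ... | yes a≤b = a≤b
  ... | no a≰b = ⊥-elim (<⇒≱ (+-mono-< (≰⇒> a≰b) (≰⇒> a≰b)) a+a≤b+b)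

-- Walks in a graph, and the Helly property of subtrees

module Walks {K : ℕ} (T : Graph K) where

  Node : Set
  Node = Fin K

  _~_ : Node → Node → Set
  _~_ = E T

  ~-sym : ∀ {x y} → x ~ y → y ~ x
  ~-sym = E-sym T

  data Walk (P : Node → Set) : Node → Node → Set where
    nil  : ∀ {u} → P u → Walk P u u
    cons : ∀ {u w v} → P u → u ~ w → Walk P w v → Walk P u v

  mapʷ : ∀ {P Q : Node → Set} → (∀ {z} → P z → Q z) → ∀ {u v} → Walk P u v → Walk Q u v
  mapʷ f (nil p) = nil (f p)
  mapʷ f (cons p e W) = cons (f p) e (mapʷ f W)

  lengthʷ : ∀ {P u v} → Walk P u v → ℕ
  lengthʷ (nil _) = 0
  lengthʷ (cons _ _ W) = suc (lengthʷ W)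

  vertexAt : ∀ {P u v} → Walk P u v → ℕ → Node
  vertexAt (nil {u} _) _ = u
  vertexAt (cons {u} _ _ _) zero = u
  vertexAt (cons _ _ W) (suc i) = vertexAt W i

  lengthʷ-map : ∀ {P Q : Node → Set} (f : ∀ {z} → P z → Q z) {u v} (W : Walk P u v) →
                lengthʷ (mapʷ f W) ≡ lengthʷ W
  lengthʷ-map f (nil p) = refl
  lengthʷ-map f (cons p e W) = cong suc (lengthʷ-map f W)

  vertexAt-map : ∀ {P Q : Node → Set} (f : ∀ {z} → P z → Q z) {u v} (W : Walk P u v) →
                 ∀ i → vertexAt (mapʷ f W) i ≡ vertexAt W i
  vertexAt-map f (nil p) i = refl
  vertexAt-map f (cons p e W) zero = refl
  vertexAt-map f (cons p e W) (suc i) = vertexAt-map f W i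

  module _ {P : Node → Set} where

    first∈ : ∀ {u v} → Walk P u v → P u
    first∈ (nil p) = p
    first∈ (cons p _ _) = p

    last∈ : ∀ {u v} → Walk P u v → P v
    last∈ (nil p) = p
    last∈ (cons _ _ W) = last∈ W

    _++ʷ_ : ∀ {u v z} → Walk P u v → Walk P v z → Walk P u z
    nil _ ++ʷ W = W
    cons p e W ++ʷ W′ = cons p e (W ++ʷ W′)

    snocʷ : ∀ {u v z} → Walk P u v → P z → v ~ z → Walk P u z
    snocʷ (nil p) q e = cons p e (nil q)
    snocʷ (cons p e W) q e′ = cons p e (snocʷ W q e′)

    reverseʷ : ∀ {u v} → Walk P u v → Walk P v u
    reverseʷ (nil p) = nil p
    reverseʷ (cons p e W) = snocʷ (reverseʷ W) p (~-sym e)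

    vertexAt-0 : ∀ {u v} (W : Walk P u v) → vertexAt W 0 ≡ u
    vertexAt-0 (nil _) = refl
    vertexAt-0 (cons _ _ _) = refl

    vertexAt-~ : ∀ {u v} (W : Walk P u v) → ∀ i → i < lengthʷ W → vertexAt W i ~ vertexAt W (suc i)
    vertexAt-~ (cons _ e W) zero _ = subst (_ ~_) (sym (vertexAt-0 W)) e
    vertexAt-~ (cons _ _ W) (suc i) (s≤s i<l) = vertexAt-~ W i i<l

    vertexAt-∈ : ∀ {u v} (W : Walk P u v) → ∀ i → P (vertexAt W i)
    vertexAt-∈ (nil p) _ = p
    vertexAt-∈ (cons p _ _) zero = p
    vertexAt-∈ (cons _ _ W) (suc i) = vertexAt-∈ W i

    lengthʷ-snoc : ∀ {u v z} (W : Walk P u v) (q : P z) (e : v ~ z) →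
                   lengthʷ (snocʷ W q e) ≡ suc (lengthʷ W)
    lengthʷ-snoc (nil p) q e = refl
    lengthʷ-snoc (cons p e W) q e′ = cong suc (lengthʷ-snoc W q e′)

    vertexAt-snoc : ∀ {u v z} (W : Walk P u v) (q : P z) (e : v ~ z) → ∀ i → i ≤ lengthʷ W →
                    vertexAt (snocʷ W q e) i ≡ vertexAt W i
    vertexAt-snoc (nil p) q e zero _ = refl
    vertexAt-snoc (cons p e W) q e′ zero _ = refl
    vertexAt-snoc (cons p e W) q e′ (suc i) (s≤s i≤l) = vertexAt-snoc W q e′ i i≤l

    vertexAt-snoc-last : ∀ {u v z} (W : Walk P u v) (q : P z) (e : v ~ z) →
                         vertexAt (snocʷ W q e) (suc (lengthʷ W)) ≡ z
    vertexAt-snoc-last (nil p) q e = refl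
    vertexAt-snoc-last (cons p e W) q e′ = vertexAt-snoc-last W q e′

    NonBacktracking : ∀ {u v} → Walk P u v → Set
    NonBacktracking (nil _) = ⊤
    NonBacktracking (cons _ _ (nil _)) = ⊤
    NonBacktracking (cons {u = u} _ _ W@(cons {w = x} _ _ _)) = x ≢ u × NonBacktracking W

    nonBacktracking-tail : ∀ {u w v} {p : P u} {e : u ~ w} (W : Walk P w v) →
                           NonBacktracking (cons p e W) → NonBacktracking W
    nonBacktracking-tail (nil _) _ = tt
    nonBacktracking-tail (cons _ _ _) (_ , nb) = nb

    removeBacktracks : ∀ {u v} → Walk P u v → Σ (Walk P u v) NonBacktracking
    removeBacktracks (nil p) = nil p , tt
    removeBacktracks (cons {u} p e W) with removeBacktracks W
    ... | nil q , _ = cons p e (nil q) , tt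
    ... | cons {w = x} q e′ W′ , nb with x ≟ u
    ...   | yes refl = W′ , nonBacktracking-tail W′ nb
    ...   | no x≢u = cons p e (cons q e′ W′) , (x≢u , nb)

    nonBacktracking-vertexAt : ∀ {u v} (W : Walk P u v) → NonBacktracking W →
                               ∀ k → 2 + k ≤ lengthʷ W → vertexAt W (2 + k) ≢ vertexAt W k
    nonBacktracking-vertexAt (cons _ _ (cons _ _ W)) (x≢u , _) zero _ eq = x≢u (trans (sym (vertexAt-0 W)) eq)
    nonBacktracking-vertexAt (cons _ _ W@(cons _ _ _)) (_ , nb) (suc k) (s≤s k+2≤l) = nonBacktracking-vertexAt W nb k k+2≤l
    nonBacktracking-vertexAt (cons _ _ (nil _)) _ k (s≤s ())

  ConnectedBetween : (Node → Set) → Node → Node → Set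
  ConnectedBetween P u v = (u ≡ v) ⊎ (∃[ ys ] (Linked _~_ (u ∷ ys ++ v ∷ []) × All P ys))

  connected⇒walk : ∀ {P : Node → Set} {u v} → P u → P v → ConnectedBetween P u v → Walk P u v
  connected⇒walk pu pv (inj₁ refl) = nil pu
  connected⇒walk {P} {v = v} pu pv (inj₂ (ys , linked , all)) = fromLinked ys pu linked all
    where
    fromLinked : ∀ {u} (ys : List Node) → P u → Linked _~_ (u ∷ ys ++ v ∷ []) → All P ys → Walk P u v
    fromLinked [] pu (e ∷ [-]) [] = cons pu e (nil pv)
    fromLinked (y ∷ ys) pu (e ∷ linked) (py ∷ all) = cons pu e (fromLinked ys py linked all)

  walk⇒connected : ∀ {P : Node → Set} {u v} → Walk P u v → ConnectedBetween P u v
  walk⇒connected (nil _) = inj₁ refl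
  walk⇒connected (cons p e W) with walk⇒connected W
  ... | inj₁ refl = inj₂ ([] , e ∷ [-] , [])
  ... | inj₂ (ys , linked , all) = inj₂ (_ ∷ ys , e ∷ linked , first∈ W ∷ all)

  avoiding-or-departing : ∀ {P : Node → Set} x {u v} → Walk P u v → x ≢ v →
    Walk (λ z → P z × z ≢ x) u v ⊎ ∃[ y ] (x ~ y × Walk (λ z → P z × z ≢ x) y v)
  avoiding-or-departing x (nil p) x≢v = inj₁ (nil (p , λ u≡x → x≢v (sym u≡x)))
  avoiding-or-departing x (cons {u} {w} p e W) x≢v with avoiding-or-departing x W x≢v
  ... | inj₂ departure = inj₂ departure
  ... | inj₁ W′ with u ≟ x
  ...   | yes refl = inj₂ (w , e , W′)
  ...   | no u≢x = inj₁ (cons (p , u≢x) e W′)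

  lastDeparture : ∀ {P : Node → Set} {x v} → Walk P x v → x ≢ v →
                  ∃[ y ] (x ~ y × Walk (λ z → P z × z ≢ x) y v)
  lastDeparture (nil p) x≢v = ⊥-elim (x≢v refl)
  lastDeparture {x = x} (cons {w = w} p e W) x≢v with avoiding-or-departing x W x≢v
  ... | inj₁ W′ = w , e , W′
  ... | inj₂ departure = departure

  RepeatsAt : (ℕ → Node) → ℕ → Set
  RepeatsAt f j = ∃[ i ] (i < j × f i ≡ f j)

  repeatsAt? : (f : ℕ → Node) → ∀ j → Dec (RepeatsAt f j)
  repeatsAt? f j with least? (λ i → f i ≟ f j) j
  ... | inj₁ (i , i<j , eq , _) = yes (i , i<j , eq)
  ... | inj₂ none = no λ (i , i<j , eq) → none i i<j eq

  firstRepeat⇒cycle : ∀ (f : ℕ → Node) i m →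
    (∀ k → k < i + suc m → f k ~ f (suc k)) → f i ≡ f (i + suc m) →
    (∀ j → j < i + suc m → ¬ RepeatsAt f j) → IsCycle T m (λ k → f (i + toℕ k))
  firstRepeat⇒cycle f i m walk closed first = injective , adjacent
    where
    inRange : ∀ (k : Fin (suc m)) → i + toℕ k < i + suc m
    inRange k = +-monoʳ-< i (s≤s (toℕ≤pred[n] k))
    injective : Injective _≡_ _≡_ (λ k → f (i + toℕ k))
    injective {k} {l} eq with <-cmp (toℕ k) (toℕ l)
    ... | tri≈ _ k≡l _ = toℕ-injective k≡l
    ... | tri< k<l _ _ = ⊥-elim (first (i + toℕ l) (inRange l) (i + toℕ k , +-monoʳ-< i k<l , eq))
    ... | tri> _ _ l<k = ⊥-elim (first (i + toℕ k) (inRange k) (i + toℕ l , +-monoʳ-< i l<k , sym eq))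
    adjacent : ∀ k → f (i + toℕ k) ~ f (i + toℕ (next k))
    adjacent k with toℕ-next k
    ... | inj₁ (_ , e) = subst (λ z → f (i + toℕ k) ~ f z)
                               (trans (sym (+-suc i (toℕ k))) (cong (i +_) (sym e)))
                               (walk (i + toℕ k) (inRange k))
    ... | inj₂ (k≡m , e) = subst (λ z → f (i + toℕ k) ~ z)
                                 (trans (cong f (trans (sym (+-suc i (toℕ k))) (cong (λ z → i + suc z) k≡m)))
                                        (trans (sym closed) (cong f (trans (sym (+-identityʳ i)) (cong (i +_) (sym e))))))
                                 (walk (i + toℕ k) (inRange k))

  module _ (acyclic : Acyclic T) where

    -- The first repetition f i = f j₀ closes a cycle of length j₀ − i, which is at least 3
    -- because f has neither loops nor backtracks.
    nonBacktracking⇒noRepeat : (f : ℕ → Node) (j : ℕ) →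
      (∀ k → k < j → f k ~ f (suc k)) → (∀ k → 2 + k ≤ j → f (2 + k) ≢ f k) → ¬ RepeatsAt f j
    nonBacktracking⇒noRepeat f j walk nb repeat with least? (repeatsAt? f) (suc j)
    ... | inj₂ none = none j (n<1+n j) repeat
    ... | inj₁ (j₀ , j₀<1+j , (i , i<j₀ , closed) , first) with <⇒∃+suc i<j₀
    ...   | zero , refl =
      E-irrefl T (subst (f i ~_) (trans (cong f (+-comm 1 i)) (sym closed)) (walk i (≤-trans (m<m+n i z<s) (≤-pred j₀<1+j))))
    ...   | suc zero , refl =
      nb i (≤-trans (≤-reflexive (+-comm 2 i)) (≤-pred j₀<1+j)) (trans (cong f (+-comm 2 i)) (sym closed))
    ...   | m@(suc (suc _)) , refl =
      acyclic m _ (s≤s (s≤s z≤n))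
              (firstRepeat⇒cycle f i m (λ k k<j₀ → walk k (≤-trans k<j₀ (≤-pred j₀<1+j))) closed first)

    noInfiniteNonBacktracking : (f : ℕ → Node) → (∀ k → f k ~ f (suc k)) → (∀ k → f (2 + k) ≢ f k) → ⊥
    noInfiniteNonBacktracking f walk nb with pigeonhole (n<1+n K) (f ∘ toℕ)
    ... | i , j , i<j , eq = nonBacktracking⇒noRepeat f (toℕ j) (λ k _ → walk k) (λ k _ → nb k) (toℕ i , i<j , eq)

    -- Closing the walk through x gives a non-backtracking closed walk x, y, …, y′, x.
    neighbours-separated : ∀ {x y y′} → x ~ y → x ~ y′ → y ≢ y′ → ¬ Walk (_≢ x) y y′
    neighbours-separated {x} {y} {y′} x~y x~y′ y≢y′ W₀ with removeBacktracks W₀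
    ... | nil _ , _ = y≢y′ refl
    ... | W@(cons _ _ _) , nbW = nonBacktracking⇒noRepeat f (2 + n) walk nb (0 , z<s , sym f-last)
      where
      n : ℕ
      n = lengthʷ W
      forget : ∀ {z} → z ≢ x → ⊤
      forget _ = tt
      W⊤ : Walk (λ _ → ⊤) y y′
      W⊤ = mapʷ forget W
      length-W⊤ : lengthʷ W⊤ ≡ n
      length-W⊤ = lengthʷ-map forget W
      C : Walk (λ _ → ⊤) x x
      C = cons tt x~y (snocʷ W⊤ tt (~-sym x~y′))
      f : ℕ → Node
      f = vertexAt C
      f-inner : ∀ i → i ≤ n → f (suc i) ≡ vertexAt W i
      f-inner i i≤n = trans (vertexAt-snoc W⊤ tt (~-sym x~y′) i (subst (i ≤_) (sym length-W⊤) i≤n))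
                            (vertexAt-map forget W i)
      f-last : f (2 + n) ≡ x
      f-last = subst (λ l → vertexAt (snocʷ W⊤ tt (~-sym x~y′)) (suc l) ≡ x) length-W⊤
                     (vertexAt-snoc-last W⊤ tt (~-sym x~y′))
      walk : ∀ k → k < 2 + n → f k ~ f (suc k)
      walk k k<l = vertexAt-~ C k (subst (k <_) (cong suc (sym length-C)) k<l)
        where
        length-C : lengthʷ (snocʷ W⊤ tt (~-sym x~y′)) ≡ suc n
        length-C = trans (lengthʷ-snoc W⊤ tt (~-sym x~y′)) (cong suc length-W⊤)
      nb : ∀ k → 2 + k ≤ 2 + n → f (2 + k) ≢ f k
      nb zero _ eq = vertexAt-∈ W 1 (trans (sym (f-inner 1 (s≤s z≤n))) eq)
      nb (suc k) (s≤s (s≤s k+1≤n)) eq with m≤n⇒m<n∨m≡n k+1≤n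
      ... | inj₁ k+2≤n = nonBacktracking-vertexAt W nbW k k+2≤n
                           (trans (sym (f-inner (2 + k) k+2≤n)) (trans eq (f-inner k (≤-trans (m≤n+m k 2) k+2≤n))))
      ... | inj₂ k+1≡n = vertexAt-∈ W k (trans (sym (f-inner k k≤n))
                                               (trans (sym eq) (trans (cong (λ l → f (2 + l)) k+1≡n) f-last)))
        where
        k≤n : k ≤ n
        k≤n = ≤-trans (n≤1+n k) k+1≤n

    edge-separates : ∀ {x y z} → x ~ y → Walk (_≢ x) y z → ¬ Walk (_≢ y) x z
    edge-separates x~y W₁ W₂ with lastDeparture W₂ (λ x≡z → last∈ W₁ (sym x≡z))
    ... | y′ , x~y′ , W₃ = neighbours-separated x~y x~y′ (λ y≡y′ → proj₁ (first∈ W₃) (sym y≡y′))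
                                                (W₁ ++ʷ reverseʷ (mapʷ proj₂ W₃))

    -- If no node lies in every S k, then from each node x step to the neighbour of x towards
    -- some S k avoiding x; two consecutive steps never backtrack, which contradicts acyclicity.
    helly : Connected T → Node → ∀ {L} (S : Fin L → Node → Set) → (∀ k x → Dec (S k x)) →
            (∀ k {u v} → S k u → S k v → Walk (S k) u v) → (∀ k l → ∃[ x ] (S k x × S l x)) →
            ∃[ x ] (∀ k → S k x)
    helly connected x₀ {L} S S? S-connected S-intersect with any? (λ x → all? (λ k → S? k x))
    ... | yes common = common
    ... | no none = ⊥-elim (noInfiniteNonBacktracking path (λ k → proj₁ (proj₂ (step (path k))))
                                                         (λ k → noReturn (step (path k)) (step (path (suc k)))))
      where
      Step : Node → Set
      Step x = ∃[ y ] (x ~ y × ∃[ k ] (¬ S k x × ∃[ s ] (S k s × Walk (_≢ x) y s)))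

      step : ∀ x → Step x
      step x with ¬∀⟶∃¬ L (λ k → S k x) (λ k → S? k x) (λ all → none (x , all))
      ... | k , x∉S with S-intersect k k
      ...   | s , s∈S , _ with lastDeparture (connected⇒walk {P = λ _ → ⊤} tt tt (connected x s tt tt))
                                             (λ x≡s → x∉S (subst (S k) (sym x≡s) s∈S))
      ...     | y , x~y , W = y , x~y , k , x∉S , s , s∈S , mapʷ proj₂ W

      noReturn : ∀ {x} (sx : Step x) (sy : Step (proj₁ sx)) → proj₁ sy ≢ x
      noReturn (y , x~y , k , x∉S , s , s∈S , W) (_ , _ , l , y∉S , t , t∈S , W′) refl
        with S-intersect k l
      ... | z , z∈Sk , z∈Sl =
        edge-separates x~y (W ++ʷ mapʷ (λ w∈S w≡x → x∉S (subst (S k) w≡x w∈S)) (S-connected k s∈S z∈Sk))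
                           (W′ ++ʷ mapʷ (λ w∈S w≡y → y∉S (subst (S l) w≡y w∈S)) (S-connected l t∈S z∈Sl))

      path : ℕ → Node
      path zero = x₀
      path (suc i) = proj₁ (step (path i))

-- Paths are trees

module PathGraph (t : ℕ) where

  succ? : Fin (suc t) → Fin (suc t) → Bool
  succ? x y = ⌊ suc (toℕ x) ≟ℕ toℕ y ⌋

  succ?-irrefl : ∀ x → succ? x x ≡ false
  succ?-irrefl x = isYes-false (suc (toℕ x) ≟ℕ toℕ x) 1+n≢n

  path : Graph (suc t)
  path = record
    { adj    = λ x y → succ? x y ∨ succ? y x
    ; symm   = λ x y → ∨-comm (succ? x y) (succ? y x)
    ; irrefl = λ x → cong₂ _∨_ (succ?-irrefl x) (succ?-irrefl x)
    }

  open Walks path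

  ~⇒succ : ∀ {x y} → x ~ y → (suc (toℕ x) ≡ toℕ y) ⊎ (suc (toℕ y) ≡ toℕ x)
  ~⇒succ {x} {y} x~y with suc (toℕ x) ≟ℕ toℕ y | suc (toℕ y) ≟ℕ toℕ x
  ... | yes x+1≡y | _ = inj₁ x+1≡y
  ... | no _ | yes y+1≡x = inj₂ y+1≡x
  ... | no _ | no _ with x~y
  ...   | ()

  succ⇒~ : ∀ {x y} → suc (toℕ x) ≡ toℕ y → x ~ y
  succ⇒~ {x} {y} x+1≡y = cong (_∨ succ? y x) (isYes-true (suc (toℕ x) ≟ℕ toℕ y) x+1≡y)

  -- A non-backtracking walk on a path is strictly monotone, so it cannot last t + 2 steps.
  noInfiniteNonBacktrackingOnPath : (f : ℕ → Node) → (∀ k → f k ~ f (suc k)) → (∀ k → f (2 + k) ≢ f k) → ⊥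
  noInfiniteNonBacktrackingOnPath f walk nb with ~⇒succ (walk 0)
  ... | inj₁ up₀ = <-irrefl refl (≤-<-trans (below (suc t)) (toℕ<n (f (suc t))))
    where
    up : ∀ k → suc (toℕ (f k)) ≡ toℕ (f (suc k))
    up zero = up₀
    up (suc k) with ~⇒succ (walk (suc k))
    ... | inj₁ p = p
    ... | inj₂ q = ⊥-elim (nb k (toℕ-injective (suc-injective (trans q (sym (up k))))))
    below : ∀ k → k ≤ toℕ (f k)
    below zero = z≤n
    below (suc k) = subst (suc k ≤_) (up k) (s≤s (below k))
  ... | inj₂ down₀ = <-irrefl refl (≤-<-trans (≤-trans (m≤m+n (suc t) _) (below (suc t))) (toℕ<n (f 0)))
    where
    down : ∀ k → suc (toℕ (f (suc k))) ≡ toℕ (f k)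
    down zero = down₀
    down (suc k) with ~⇒succ (walk (suc k))
    ... | inj₂ q = q
    ... | inj₁ p = ⊥-elim (nb k (toℕ-injective (trans (sym p) (down k))))
    below : ∀ k → k + toℕ (f k) ≤ toℕ (f 0)
    below zero = ≤-refl
    below (suc k) = subst (_≤ toℕ (f 0)) (trans (cong (k +_) (sym (down k))) (+-suc k _)) (below k)

  path-acyclic : Acyclic path
  path-acyclic m c 2≤m (injective , adjacent) =
    noInfiniteNonBacktrackingOnPath (c ∘ iterate) (adjacent ∘ iterate) (λ k eq → next²≢id 2≤m (iterate k) (injective eq))
    where
    iterate : ℕ → Fin (suc m)
    iterate zero = zero
    iterate (suc i) = next (iterate i)

  ascendingWalk : {Q : Node → Set} → ∀ d (u v : Node) → toℕ u + d ≡ toℕ v →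
                  (∀ y → toℕ u ≤ toℕ y → toℕ y ≤ toℕ v → Q y) → Walk Q u v
  ascendingWalk {Q} zero u v u+0≡v Q-between
    with toℕ-injective {i = u} {j = v} (trans (sym (+-identityʳ _)) u+0≡v)
  ... | refl = nil (Q-between u ≤-refl ≤-refl)
  ascendingWalk {Q} (suc d) u v u+d+1≡v Q-between =
    cons (Q-between u ≤-refl (subst (toℕ u ≤_) u+d+1≡v (m≤m+n _ _)))
         (succ⇒~ (sym (toℕ-fromℕ< u+1<t+1)))
         (ascendingWalk d u′ v u′+d≡v
           (λ y u′≤y y≤v → Q-between y (≤-trans (n≤1+n _) (subst (_≤ toℕ y) (toℕ-fromℕ< u+1<t+1) u′≤y)) y≤v))
    where
    u+1<t+1 : suc (toℕ u) < suc t
    u+1<t+1 = ≤-<-trans (subst (suc (toℕ u) ≤_) (trans (sym (+-suc (toℕ u) d)) u+d+1≡v) (s≤s (m≤m+n _ d))) (toℕ<n v)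
    u′ : Node
    u′ = fromℕ< u+1<t+1
    u′+d≡v : toℕ u′ + d ≡ toℕ v
    u′+d≡v = trans (cong (_+ d) (toℕ-fromℕ< u+1<t+1)) (trans (sym (+-suc (toℕ u) d)) u+d+1≡v)

  Between : Node → Node → Node → Set
  Between u v y = (toℕ u ≤ toℕ y × toℕ y ≤ toℕ v) ⊎ (toℕ v ≤ toℕ y × toℕ y ≤ toℕ u)

  intervalWalk : {Q : Node → Set} (u v : Node) → (∀ y → Between u v y → Q y) → Walk Q u v
  intervalWalk u v Q-between with ≤-total (toℕ u) (toℕ v)
  ... | inj₁ u≤v = ascendingWalk (toℕ v ∸ toℕ u) u v (m+[n∸m]≡n u≤v) (λ y a b → Q-between y (inj₁ (a , b)))
  ... | inj₂ v≤u =
    reverseʷ (ascendingWalk (toℕ u ∸ toℕ v) v u (m+[n∸m]≡n v≤u) (λ y a b → Q-between y (inj₂ (a , b))))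

  path-isTree : IsTree path
  path-isTree = (λ u v _ _ → walk⇒connected (intervalWalk {Q = λ _ → ⊤} u v (λ _ _ → tt))) , path-acyclic

TreewidthAtLeast : ∀ {N} → Graph N → ℕ → Set
TreewidthAtLeast G k = ∀ w (D : TreeDecomposition G) → WidthAtMost D w → k ≤ w

restrict : ∀ {N} {G H : Graph N} → Subgraph G H → TreeDecomposition H → TreeDecomposition G
restrict G⊆H D = record
  { t = TreeDecomposition.t D ; T = T D ; isTree = isTree D ; bag = bag D ; covers = covers D
  ; edgeIn = λ u v e → edgeIn D u v (G⊆H u v e) ; subtree = subtree D }

treewidthAtLeast-supergraph : ∀ {N} {G H : Graph N} {k} → Subgraph G H →
                              TreewidthAtLeast G k → TreewidthAtLeast H k
treewidthAtLeast-supergraph G⊆H tw≥k w D = tw≥k w (restrict G⊆H D)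

edgeIndicator : ∀ {N} → Graph N → Fin N → Fin N → ℕ
edgeIndicator K i j = if (toℕ i <ᵇ toℕ j) ∧ adj K i j then 1 else 0

edgeCount≡∑∑ : ∀ {N} (K : Graph N) → edgeCount K ≡ ∑∑ (edgeIndicator K)
edgeCount≡∑∑ {N} K = trans (sum-map-allFin (λ i → sum (map (edgeIndicator K i) (allFin N))))
                           (sum-cong-≗ (λ i → sum-map-allFin (edgeIndicator K i)))

edgeIndicator-mono : ∀ {N} (K K′ : Graph N) i j → (E K i j → E K′ i j) → edgeIndicator K i j ≤ edgeIndicator K′ i j
edgeIndicator-mono K K′ i j K⊆K′ with toℕ i <ᵇ toℕ j | adj K i j | adj K′ i j | K⊆K′
... | false | _ | _ | _ = z≤n
... | true | false | _ | _ = z≤n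
... | true | true | true | _ = ≤-refl
... | true | true | false | K⊆K′′ with K⊆K′′ refl
...   | ()

edgeIndicator-< : ∀ {N} (K : Graph N) {i j} → toℕ i < toℕ j → edgeIndicator K i j ≡ indicator (adj K i j)
edgeIndicator-< K {i} {j} i<j with toℕ i <ᵇ toℕ j | <⇒<ᵇ i<j
... | true | _ = refl

edgeIndicator-≥ : ∀ {N} (K : Graph N) {i j} → toℕ j ≤ toℕ i → edgeIndicator K i j ≡ 0
edgeIndicator-≥ K {i} {j} j≤i with toℕ i <ᵇ toℕ j in i<ᵇj
... | false = refl
... | true = ⊥-elim (<⇒≱ (<ᵇ⇒< (toℕ i) (toℕ j) (subst Tᵇ (sym i<ᵇj) tt)) j≤i)

-- The rook's graph K₂ □ Kₙ and its staircase triangulation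

module RookK₂ (t : ℕ) where

  n : ℕ
  n = suc t

  V : Set
  V = Fin (2 * n)

  G : Graph (2 * n)
  G = Rook 2 n

  position : V → Fin 2 × Fin n
  position = remQuot {2} n

  -- A c and B c are the vertices v₁,c and v₂,c.
  A B : Fin n → V
  A c = combine {2} {n} zero c
  B c = combine {2} {n} (suc zero) c

  position-A : ∀ c → position (A c) ≡ (zero , c)
  position-A = remQuot-combine zero

  position-B : ∀ c → position (B c) ≡ (suc zero , c)
  position-B = remQuot-combine (suc zero)

  data View : V → Set where
    inA : ∀ c → View (A c)
    inB : ∀ c → View (B c)

  view : ∀ v → View v
  view v with position v in eq
  ... | zero , c = subst View (trans (cong (uncurry combine) (sym eq)) (combine-remQuot n v)) (inA c)
  ... | suc zero , c = subst View (trans (cong (uncurry combine) (sym eq)) (combine-remQuot n v)) (inB c)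

  A-injective : ∀ {c d} → A c ≡ A d → c ≡ d
  A-injective {c} {d} eq = cong proj₂ (trans (sym (position-A c)) (trans (cong position eq) (position-A d)))

  B-injective : ∀ {c d} → B c ≡ B d → c ≡ d
  B-injective {c} {d} eq = cong proj₂ (trans (sym (position-B c)) (trans (cong position eq) (position-B d)))

  A≢B : ∀ {c d} → A c ≢ B d
  A≢B {c} {d} eq with trans (sym (position-A c)) (trans (cong position eq) (position-B d))
  ... | ()

  not-eqᵇ : ∀ {c d : Fin n} → c ≢ d → not (eqᵇ c d) ≡ true
  not-eqᵇ {c} {d} c≢d = cong not (isYes-false (c ≟ d) c≢d)

  onPositions : (Fin 2 × Fin n → Fin 2 × Fin n → Bool) → V → V → Bool
  onPositions R u v = R (position u) (position v)

  rook : Fin 2 × Fin n → Fin 2 × Fin n → Bool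
  rook (r , c) (r′ , c′) = eqᵇ r r′ xor eqᵇ c c′

  G-adj-AA : ∀ c d → adj G (A c) (A d) ≡ not (eqᵇ c d)
  G-adj-AA c d = cong₂ rook (position-A c) (position-A d)

  G-adj-AB : ∀ c d → adj G (A c) (B d) ≡ eqᵇ c d
  G-adj-AB c d = cong₂ rook (position-A c) (position-B d)

  G-adj-BA : ∀ c d → adj G (B c) (A d) ≡ eqᵇ c d
  G-adj-BA c d = cong₂ rook (position-B c) (position-A d)

  G-adj-BB : ∀ c d → adj G (B c) (B d) ≡ not (eqᵇ c d)
  G-adj-BB c d = cong₂ rook (position-B c) (position-B d)

  G-AA : ∀ {c d} → c ≢ d → E G (A c) (A d)
  G-AA {c} {d} c≢d = trans (G-adj-AA c d) (not-eqᵇ c≢d)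

  G-BB : ∀ {c d} → c ≢ d → E G (B c) (B d)
  G-BB {c} {d} c≢d = trans (G-adj-BB c d) (not-eqᵇ c≢d)

  G-AB : ∀ c → E G (A c) (B c)
  G-AB c = trans (G-adj-AB c c) (eqᵇ-refl c)

  G-BA : ∀ c → E G (B c) (A c)
  G-BA c = trans (G-adj-BA c c) (eqᵇ-refl c)

  staircase : Fin 2 × Fin n → Fin 2 × Fin n → Bool
  staircase (zero , c) (zero , d) = not (eqᵇ c d)
  staircase (zero , c) (suc zero , d) = ⌊ toℕ d ≤? toℕ c ⌋
  staircase (suc zero , c) (zero , d) = ⌊ toℕ c ≤? toℕ d ⌋
  staircase (suc zero , c) (suc zero , d) = not (eqᵇ c d)

  staircase-sym : ∀ p q → staircase p q ≡ staircase q p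
  staircase-sym (zero , c) (zero , d) = cong not (eqᵇ-sym c d)
  staircase-sym (zero , c) (suc zero , d) = refl
  staircase-sym (suc zero , c) (zero , d) = refl
  staircase-sym (suc zero , c) (suc zero , d) = cong not (eqᵇ-sym c d)

  staircase-irrefl : ∀ p → staircase p p ≡ false
  staircase-irrefl (zero , c) = cong not (eqᵇ-refl c)
  staircase-irrefl (suc zero , c) = cong not (eqᵇ-refl c)

  H : Graph (2 * n)
  H = record
    { adj    = onPositions staircase
    ; symm   = λ u v → staircase-sym (position u) (position v)
    ; irrefl = λ v → staircase-irrefl (position v)
    }

  H-adj-AA : ∀ c d → adj H (A c) (A d) ≡ not (eqᵇ c d)
  H-adj-AA c d = cong₂ staircase (position-A c) (position-A d)

  H-adj-AB : ∀ c d → adj H (A c) (B d) ≡ ⌊ toℕ d ≤? toℕ c ⌋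
  H-adj-AB c d = cong₂ staircase (position-A c) (position-B d)

  H-adj-BA : ∀ c d → adj H (B c) (A d) ≡ ⌊ toℕ c ≤? toℕ d ⌋
  H-adj-BA c d = cong₂ staircase (position-B c) (position-A d)

  H-adj-BB : ∀ c d → adj H (B c) (B d) ≡ not (eqᵇ c d)
  H-adj-BB c d = cong₂ staircase (position-B c) (position-B d)

  H-AA : ∀ {c d} → c ≢ d → E H (A c) (A d)
  H-AA {c} {d} c≢d = trans (H-adj-AA c d) (not-eqᵇ c≢d)

  H-BB : ∀ {c d} → c ≢ d → E H (B c) (B d)
  H-BB {c} {d} c≢d = trans (H-adj-BB c d) (not-eqᵇ c≢d)

  H-AB : ∀ {c d} → toℕ d ≤ toℕ c → E H (A c) (B d)
  H-AB {c} {d} d≤c = trans (H-adj-AB c d) (isYes-true (toℕ d ≤? toℕ c) d≤c)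

  H-AB⁻¹ : ∀ {c d} → E H (A c) (B d) → toℕ d ≤ toℕ c
  H-AB⁻¹ {c} {d} e = isYes-witness (toℕ d ≤? toℕ c) (trans (sym (H-adj-AB c d)) e)

  G⊆H : Subgraph G H
  G⊆H u v = go (view u) (view v)
    where
    go : ∀ {u v} → View u → View v → E G u v → E H u v
    go (inA c) (inA d) e = trans (H-adj-AA c d) (trans (sym (G-adj-AA c d)) e)
    go (inB c) (inB d) e = trans (H-adj-BB c d) (trans (sym (G-adj-BB c d)) e)
    go (inA c) (inB d) e with isYes-witness (c ≟ d) (trans (sym (G-adj-AB c d)) e)
    ... | refl = H-AB {c} {c} ≤-refl
    go (inB c) (inA d) e with isYes-witness (c ≟ d) (trans (sym (G-adj-BA c d)) e)
    ... | refl = trans (H-adj-BA c c) (isYes-true (toℕ c ≤? toℕ c) ≤-refl)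

  rankOf : Fin 2 × Fin n → ℕ
  rankOf (zero , c) = toℕ c
  rankOf (suc zero , _) = n

  rank : V → ℕ
  rank v = rankOf (position v)

  B-after-A : ∀ c d → ¬ rank (B d) ≤ rank (A c)
  B-after-A c d B≤A = <⇒≱ (toℕ<n c) (subst₂ _≤_ (cong rankOf (position-B d)) (cong rankOf (position-A c)) B≤A)

  H-later-neighbours-adjacent : ∀ {w u v} → E H w u → E H w v → rank w ≤ rank u → rank w ≤ rank v → u ≢ v → E H u v
  H-later-neighbours-adjacent {w} {u} {v} = go (view w) (view u) (view v)
    where
    ≤-rank : ∀ {c c′} → rank (A c) ≤ rank (A c′) → toℕ c ≤ toℕ c′
    ≤-rank {c} {c′} = subst₂ _≤_ (cong rankOf (position-A c)) (cong rankOf (position-A c′))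
    go : ∀ {w u v} → View w → View u → View v →
         E H w u → E H w v → rank w ≤ rank u → rank w ≤ rank v → u ≢ v → E H u v
    go (inA c) (inA c₁) (inA c₂) _ _ _ _ u≢v = H-AA {c₁} {c₂} (λ c₁≡c₂ → u≢v (cong A c₁≡c₂))
    go (inA c) (inA c₁) (inB d) _ c~d c≤c₁ _ _ = H-AB {c₁} {d} (≤-trans (H-AB⁻¹ {c} c~d) (≤-rank {c} {c₁} c≤c₁))
    go (inA c) (inB d) (inA c₂) c~d _ _ c≤c₂ _ =
      E-sym H {A c₂} {B d} (H-AB {c₂} {d} (≤-trans (H-AB⁻¹ {c} c~d) (≤-rank {c} {c₂} c≤c₂)))
    go (inA c) (inB d₁) (inB d₂) _ _ _ _ u≢v = H-BB {d₁} {d₂} (λ d₁≡d₂ → u≢v (cong B d₁≡d₂))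
    go (inB d) (inA c) _ _ _ d≤c _ _ = ⊥-elim (B-after-A c d d≤c)
    go (inB d) (inB _) (inA c) _ _ _ d≤c _ = ⊥-elim (B-after-A c d d≤c)
    go (inB d) (inB d₁) (inB d₂) _ _ _ _ u≢v = H-BB {d₁} {d₂} (λ d₁≡d₂ → u≢v (cong B d₁≡d₂))

  H-chordal : Chordal H
  H-chordal = perfectElimination⇒chordal H rank (λ {w} {u} {v} → H-later-neighbours-adjacent {w} {u} {v})

  square : Fin n → Fin n → Fin 4 → V
  square c d zero = A c
  square c d (suc zero) = A d
  square c d (suc (suc zero)) = B d
  square c d (suc (suc (suc zero))) = B c

  square-injective : ∀ {c d} → c ≢ d → Injective _≡_ _≡_ (square c d)
  square-injective c≢d {zero} {zero} _ = refl
  square-injective c≢d {zero} {suc zero} eq = ⊥-elim (c≢d (A-injective eq))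
  square-injective c≢d {zero} {suc (suc zero)} eq = ⊥-elim (A≢B eq)
  square-injective c≢d {zero} {suc (suc (suc zero))} eq = ⊥-elim (A≢B eq)
  square-injective c≢d {suc zero} {zero} eq = ⊥-elim (c≢d (A-injective (sym eq)))
  square-injective c≢d {suc zero} {suc zero} _ = refl
  square-injective c≢d {suc zero} {suc (suc zero)} eq = ⊥-elim (A≢B eq)
  square-injective c≢d {suc zero} {suc (suc (suc zero))} eq = ⊥-elim (A≢B eq)
  square-injective c≢d {suc (suc zero)} {zero} eq = ⊥-elim (A≢B (sym eq))
  square-injective c≢d {suc (suc zero)} {suc zero} eq = ⊥-elim (A≢B (sym eq))
  square-injective c≢d {suc (suc zero)} {suc (suc zero)} _ = refl
  square-injective c≢d {suc (suc zero)} {suc (suc (suc zero))} eq = ⊥-elim (c≢d (B-injective (sym eq)))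
  square-injective c≢d {suc (suc (suc zero))} {zero} eq = ⊥-elim (A≢B (sym eq))
  square-injective c≢d {suc (suc (suc zero))} {suc zero} eq = ⊥-elim (A≢B (sym eq))
  square-injective c≢d {suc (suc (suc zero))} {suc (suc zero)} eq = ⊥-elim (c≢d (B-injective eq))
  square-injective c≢d {suc (suc (suc zero))} {suc (suc (suc zero))} _ = refl

  square-cycle : ∀ {c d} → c ≢ d → IsCycle G 3 (square c d)
  square-cycle {c} {d} c≢d = square-injective c≢d , adjacent
    where
    adjacent : ∀ i → E G (square c d i) (square c d (next i))
    adjacent zero = G-AA c≢d
    adjacent (suc zero) = G-AB d
    adjacent (suc (suc zero)) = G-BB (c≢d ∘ sym)
    adjacent (suc (suc (suc zero))) = G-BA c

  triangulation-diagonal : ∀ H′ → IsTriangulation G H′ → ∀ {c d} → c ≢ d →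
                           E H′ (A c) (B d) ⊎ E H′ (A d) (B c)
  triangulation-diagonal H′ (chordal , G⊆H′) {c} {d} c≢d
    with chordal 3 (square c d) (s≤s (s≤s (s≤s z≤n)))
                 (isCycle-supergraph {G = G} {H′} {f = square c d} G⊆H′ (square-cycle c≢d))
  ... | i , j , j≢i+1 , i≢j+1 , chord with nonConsecutive-4-cycle i j j≢i+1 i≢j+1
  ...   | inj₁ refl = ⊥-elim (E-irrefl H′ chord)
  ...   | inj₂ refl = opposite i chord
    where
    opposite : ∀ i → E H′ (square c d i) (square c d (next (next i))) → E H′ (A c) (B d) ⊎ E H′ (A d) (B c)
    opposite zero e = inj₁ e
    opposite (suc zero) e = inj₂ e
    opposite (suc (suc zero)) e = inj₁ (E-sym H′ e)
    opposite (suc (suc (suc zero))) e = inj₂ (E-sym H′ e)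

  open PathGraph t using (path; path-isTree; Between; intervalWalk)
  open Walks path using (walk⇒connected)

  inBagAt : Fin n → Fin 2 × Fin n → Bool
  inBagAt j (zero , c) = ⌊ toℕ j ≤? toℕ c ⌋
  inBagAt j (suc zero , d) = ⌊ toℕ d ≤? toℕ j ⌋

  bagAt : Fin n → Subset (2 * n)
  bagAt j = tabulate (inBagAt j ∘ position)

  lookup-bagAt-A : ∀ j c → lookup (bagAt j) (A c) ≡ ⌊ toℕ j ≤? toℕ c ⌋
  lookup-bagAt-A j c = trans (lookup∘tabulate (inBagAt j ∘ position) (A c)) (cong (inBagAt j) (position-A c))

  lookup-bagAt-B : ∀ j d → lookup (bagAt j) (B d) ≡ ⌊ toℕ d ≤? toℕ j ⌋
  lookup-bagAt-B j d = trans (lookup∘tabulate (inBagAt j ∘ position) (B d)) (cong (inBagAt j) (position-B d))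

  A∈bagAt : ∀ {j c} → toℕ j ≤ toℕ c → A c ∈ₛ bagAt j
  A∈bagAt {j} {c} j≤c = lookup⇒[]= (A c) (bagAt j) (trans (lookup-bagAt-A j c) (isYes-true (toℕ j ≤? toℕ c) j≤c))

  B∈bagAt : ∀ {j d} → toℕ d ≤ toℕ j → B d ∈ₛ bagAt j
  B∈bagAt {j} {d} d≤j = lookup⇒[]= (B d) (bagAt j) (trans (lookup-bagAt-B j d) (isYes-true (toℕ d ≤? toℕ j) d≤j))

  A∈bagAt⁻¹ : ∀ {j c} → A c ∈ₛ bagAt j → toℕ j ≤ toℕ c
  A∈bagAt⁻¹ {j} {c} A∈ = isYes-witness (toℕ j ≤? toℕ c) (trans (sym (lookup-bagAt-A j c)) ([]=⇒lookup A∈))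

  B∈bagAt⁻¹ : ∀ {j d} → B d ∈ₛ bagAt j → toℕ d ≤ toℕ j
  B∈bagAt⁻¹ {j} {d} B∈ = isYes-witness (toℕ d ≤? toℕ j) (trans (sym (lookup-bagAt-B j d)) ([]=⇒lookup B∈))

  lastColumn : Fin n
  lastColumn = fromℕ t

  ≤-lastColumn : ∀ (d : Fin n) → toℕ d ≤ toℕ lastColumn
  ≤-lastColumn d = subst (toℕ d ≤_) (sym (toℕ-fromℕ t)) (toℕ≤pred[n] d)

  bagAt-covers : ∀ v → ∃[ j ] (v ∈ₛ bagAt j)
  bagAt-covers v with view v
  ... | inA c = zero , A∈bagAt z≤n
  ... | inB d = lastColumn , B∈bagAt (≤-lastColumn d)

  bagAt-edgeIn : ∀ u v → E H u v → ∃[ j ] (u ∈ₛ bagAt j × v ∈ₛ bagAt j)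
  bagAt-edgeIn u v = go (view u) (view v)
    where
    go : ∀ {u v} → View u → View v → E H u v → ∃[ j ] (u ∈ₛ bagAt j × v ∈ₛ bagAt j)
    go (inA c) (inA c′) _ = zero , A∈bagAt z≤n , A∈bagAt z≤n
    go (inB d) (inB d′) _ = lastColumn , B∈bagAt (≤-lastColumn d) , B∈bagAt (≤-lastColumn d′)
    go (inA c) (inB d) c~d = d , A∈bagAt (H-AB⁻¹ {c} c~d) , B∈bagAt ≤-refl
    go (inB d) (inA c) d~c = d , B∈bagAt ≤-refl , A∈bagAt (H-AB⁻¹ {c} (E-sym H {B d} {A c} d~c))

  bagAt-subtree : ∀ v → ConnectedOn path (λ j → v ∈ₛ bagAt j)
  bagAt-subtree v x y v∈x v∈y = walk⇒connected (intervalWalk x y (go (view v) v∈x v∈y))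
    where
    go : ∀ {v} → View v → v ∈ₛ bagAt x → v ∈ₛ bagAt y → ∀ z → Between x y z → v ∈ₛ bagAt z
    go (inA c) _ A∈y z (inj₁ (_ , z≤y)) = A∈bagAt (≤-trans z≤y (A∈bagAt⁻¹ A∈y))
    go (inA c) A∈x _ z (inj₂ (_ , z≤x)) = A∈bagAt (≤-trans z≤x (A∈bagAt⁻¹ A∈x))
    go (inB d) B∈x _ z (inj₁ (x≤z , _)) = B∈bagAt (≤-trans (B∈bagAt⁻¹ B∈x) x≤z)
    go (inB d) _ B∈y z (inj₂ (y≤z , _)) = B∈bagAt (≤-trans (B∈bagAt⁻¹ B∈y) y≤z)

  pathDecomposition : TreeDecomposition H
  pathDecomposition = record
    { t = t ; T = path ; isTree = path-isTree ; bag = bagAt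
    ; covers = bagAt-covers ; edgeIn = bagAt-edgeIn ; subtree = bagAt-subtree }

  ∑-vertices : ∀ (g : V → ℕ) → ∑ g ≡ ∑ (g ∘ A) + ∑ (g ∘ B)
  ∑-vertices g = trans (∑-++ n (n + 0) g)
                       (cong (∑ (g ∘ A) +_) (trans (∑-++ n 0 (λ j → g (n ↑ʳ j))) (+-identityʳ _)))

  [_≤_] : Fin n → Fin n → ℕ
  [ a ≤ b ] = indicator ⌊ toℕ a ≤? toℕ b ⌋

  ∣bagAt∣ : ∀ j → ∣ bagAt j ∣ ≡ ∑ (λ c → [ j ≤ c ] + [ c ≤ j ])
  ∣bagAt∣ j = begin
    ∣ bagAt j ∣                                          ≡⟨ ∣p∣≡∑ (bagAt j) ⟩
    ∑ (indicator ∘ lookup (bagAt j))                     ≡⟨ ∑-vertices (indicator ∘ lookup (bagAt j)) ⟩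
    ∑ (indicator ∘ lookup (bagAt j) ∘ A) + ∑ (indicator ∘ lookup (bagAt j) ∘ B)
      ≡⟨ cong₂ _+_ (sum-cong-≗ (cong indicator ∘ lookup-bagAt-A j)) (sum-cong-≗ (cong indicator ∘ lookup-bagAt-B j)) ⟩
    ∑ (λ c → [ j ≤ c ]) + ∑ (λ c → [ c ≤ j ])
      ≡⟨ sym (∑-distrib-+ (λ c → [ j ≤ c ]) (λ c → [ c ≤ j ])) ⟩
    ∑ (λ c → [ j ≤ c ] + [ c ≤ j ]) ∎
    where open ≡-Reasoning

  ≤-either-way : ∀ (j c : Fin n) → [ j ≤ c ] + [ c ≤ j ] ≤ 1 + δ c j
  ≤-either-way j c with toℕ j ≤? toℕ c | toℕ c ≤? toℕ j
  ... | yes j≤c | yes c≤j rewrite toℕ-injective (≤-antisym c≤j j≤c) | δ-refl j = ≤-refl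
  ... | yes _ | no _ = s≤s z≤n
  ... | no _ | yes _ = s≤s z≤n
  ... | no _ | no _ = z≤n

  pathDecomposition-width : WidthAtMost pathDecomposition n
  pathDecomposition-width j = begin
    ∣ bagAt j ∣                        ≡⟨ ∣bagAt∣ j ⟩
    ∑ (λ c → [ j ≤ c ] + [ c ≤ j ]) ≤⟨ ∑-mono-≤ (≤-either-way j) ⟩
    ∑ (λ c → 1 + δ c j)                ≡⟨ ∑-distrib-+ (λ _ → 1) (λ c → δ c j) ⟩
    ∑ {n} (λ _ → 1) + ∑ (λ c → δ c j)  ≡⟨ cong₂ _+_ (∑-ones n) (∑-δ j) ⟩
    n + 1                              ≡⟨ +-comm n 1 ⟩
    suc n                              ∎
    where open ≤-Reasoning

  ∣p∣≥1+n : ∀ (p : Subset (2 * n)) c → A c ∈ₛ p → (∀ d → B d ∈ₛ p) → suc n ≤ ∣ p ∣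
  ∣p∣≥1+n p c A∈p B⊆p = begin
    suc n                                                       ≤⟨ +-mono-≤ A-part (≤-reflexive (sym B-part)) ⟩
    ∑ (indicator ∘ lookup p ∘ A) + ∑ (indicator ∘ lookup p ∘ B) ≡⟨ sym (∑-vertices (indicator ∘ lookup p)) ⟩
    ∑ (indicator ∘ lookup p)                                    ≡⟨ sym (∣p∣≡∑ p) ⟩
    ∣ p ∣                                                       ∎
    where
    open ≤-Reasoning
    A-part : 1 ≤ ∑ (indicator ∘ lookup p ∘ A)
    A-part = subst (_≤ ∑ (indicator ∘ lookup p ∘ A)) (cong indicator ([]=⇒lookup A∈p))
                   (term≤∑ (indicator ∘ lookup p ∘ A) c)
    B-part : ∑ (indicator ∘ lookup p ∘ B) ≡ n
    B-part = trans (sum-cong-≗ (λ d → cong indicator ([]=⇒lookup (B⊆p d)))) (∑-ones n)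

  module _ (D : TreeDecomposition G) where

    open Walks (T D)

    Meets : Fin (suc n) → Node → Set
    Meets zero x = ∃[ c ] (A c ∈ₛ bag D x)
    Meets (suc d) x = B d ∈ₛ bag D x

    meets? : ∀ k x → Dec (Meets k x)
    meets? zero x = any? (λ c → A c ∈? bag D x)
    meets? (suc d) x = B d ∈? bag D x

    subtreeWalk : ∀ v {x y} → v ∈ₛ bag D x → v ∈ₛ bag D y → Walk (λ z → v ∈ₛ bag D z) x y
    subtreeWalk v {x} {y} v∈x v∈y = connected⇒walk v∈x v∈y (subtree D v x y v∈x v∈y)

    meets-connected : ∀ k {x y} → Meets k x → Meets k y → Walk (Meets k) x y
    meets-connected (suc d) = subtreeWalk (B d)
    meets-connected zero (c₁ , A₁∈x) (c₂ , A₂∈y) with c₁ ≟ c₂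
    ... | yes refl = mapʷ (c₁ ,_) (subtreeWalk (A c₁) A₁∈x A₂∈y)
    ... | no c₁≢c₂ with edgeIn D (A c₁) (A c₂) (G-AA c₁≢c₂)
    ...   | z , A₁∈z , A₂∈z =
      mapʷ (c₁ ,_) (subtreeWalk (A c₁) A₁∈x A₁∈z) ++ʷ mapʷ (c₂ ,_) (subtreeWalk (A c₂) A₂∈z A₂∈y)

    meets-intersect : ∀ k l → ∃[ x ] (Meets k x × Meets l x)
    meets-intersect zero zero with covers D (A zero)
    ... | x , A∈x = x , (zero , A∈x) , (zero , A∈x)
    meets-intersect zero (suc d) with edgeIn D (A d) (B d) (G-AB d)
    ... | x , A∈x , B∈x = x , (d , A∈x) , B∈x
    meets-intersect (suc d) zero with edgeIn D (A d) (B d) (G-AB d)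
    ... | x , A∈x , B∈x = x , B∈x , (d , A∈x)
    meets-intersect (suc d) (suc d′) with d ≟ d′
    ... | yes refl with covers D (B d)
    ...   | x , B∈x = x , B∈x , B∈x
    meets-intersect (suc d) (suc d′) | no d≢d′ with edgeIn D (B d) (B d′) (G-BB d≢d′)
    ...   | x , B∈x , B′∈x = x , B∈x , B′∈x

    bag-meeting-all : ∃[ x ] (∀ k → Meets k x)
    bag-meeting-all = helly (proj₂ (isTree D)) (proj₁ (isTree D)) zero Meets meets? meets-connected meets-intersect

  G-treewidth≥n : TreewidthAtLeast G n
  G-treewidth≥n w D width≤w with bag-meeting-all D
  ... | x , meetsAll with meetsAll zero
  ...   | c , A∈x = ≤-pred (≤-trans (∣p∣≥1+n (bag D x) c A∈x (meetsAll ∘ suc)) (width≤w x))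

  A<B : ∀ c d → toℕ (A c) < toℕ (B d)
  A<B c d = subst₂ _<_ (sym (toℕ-↑ˡ c (n + 0))) (sym (toℕ-↑ʳ n (d ↑ˡ 0))) (≤-trans (toℕ<n c) (m≤m+n n _))

  module Blocks (K : Graph (2 * n)) where
    AA AB BA BB : Fin n → Fin n → ℕ
    AA c d = edgeIndicator K (A c) (A d)
    AB c d = edgeIndicator K (A c) (B d)
    BA c d = edgeIndicator K (B c) (A d)
    BB c d = edgeIndicator K (B c) (B d)

    edgeCount-blocks : edgeCount K ≡ (∑∑ AA + ∑∑ AB) + (∑∑ BA + ∑∑ BB)
    edgeCount-blocks = begin
      edgeCount K                                      ≡⟨ edgeCount≡∑∑ K ⟩
      ∑ (∑ ∘ edgeIndicator K)                          ≡⟨ ∑-vertices (∑ ∘ edgeIndicator K) ⟩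
      ∑ (∑ ∘ edgeIndicator K ∘ A) + ∑ (∑ ∘ edgeIndicator K ∘ B) ≡⟨ cong₂ _+_ (row A) (row B) ⟩
      (∑∑ AA + ∑∑ AB) + (∑∑ BA + ∑∑ BB)               ∎
      where
      open ≡-Reasoning
      row : (u : Fin n → V) → ∑ (∑ ∘ edgeIndicator K ∘ u) ≡
            ∑∑ (λ c d → edgeIndicator K (u c) (A d)) + ∑∑ (λ c d → edgeIndicator K (u c) (B d))
      row u = trans (sum-cong-≗ (∑-vertices ∘ edgeIndicator K ∘ u))
                    (∑-distrib-+ (λ c → ∑ (λ d → edgeIndicator K (u c) (A d))) (λ c → ∑ (λ d → edgeIndicator K (u c) (B d))))

    AB≡indicator : ∀ c d → AB c d ≡ indicator (adj K (A c) (B d))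
    AB≡indicator c d = edgeIndicator-< K (A<B c d)

    BA≡0 : ∀ c d → BA c d ≡ 0
    BA≡0 c d = edgeIndicator-≥ K (<⇒≤ (A<B d c))

  cross-pair-≤ : ∀ H′ → IsTriangulation G H′ → ∀ c d →
                 [ d ≤ c ] + [ c ≤ d ] ≤ indicator (adj H′ (A c) (B d)) + indicator (adj H′ (A d) (B c))
  cross-pair-≤ H′ triangulation@(_ , G⊆H′) c d with c ≟ d
  ... | yes refl rewrite G⊆H′ (A c) (B c) (G-AB c) =
    +-mono-≤ (indicator≤1 ⌊ toℕ c ≤? toℕ c ⌋) (indicator≤1 ⌊ toℕ c ≤? toℕ c ⌋)
  ... | no c≢d = ≤-trans (subst ([ d ≤ c ] + [ c ≤ d ] ≤_) (cong suc (δ-≢ c≢d)) (≤-either-way d c))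
                         (diagonal-present (triangulation-diagonal H′ triangulation c≢d))
    where
    diagonal-present : ∀ {a b} → a ≡ true ⊎ b ≡ true → 1 ≤ indicator a + indicator b
    diagonal-present (inj₁ refl) = s≤s z≤n
    diagonal-present {a} (inj₂ refl) = m≤n+m 1 (indicator a)

  H-minimum : ∀ H′ → IsTriangulation G H′ → edgeCount H ≤ edgeCount H′
  H-minimum H′ triangulation@(_ , G⊆H′) = begin
    edgeCount H                                              ≡⟨ H.edgeCount-blocks ⟩
    (∑∑ H.AA + ∑∑ H.AB) + (∑∑ H.BA + ∑∑ H.BB)
      ≤⟨ +-mono-≤ (+-mono-≤ AA≤ AB≤) (+-mono-≤ BA≤ BB≤) ⟩
    (∑∑ H′.AA + ∑∑ H′.AB) + (∑∑ H′.BA + ∑∑ H′.BB)            ≡⟨ sym H′.edgeCount-blocks ⟩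
    edgeCount H′                                             ∎
    where
    open ≤-Reasoning
    module H = Blocks H
    module H′ = Blocks H′
    AA≤ : ∑∑ H.AA ≤ ∑∑ H′.AA
    AA≤ = ∑-mono-≤ λ c → ∑-mono-≤ λ d → edgeIndicator-mono H H′ (A c) (A d)
            (λ e → G⊆H′ _ _ (trans (G-adj-AA c d) (trans (sym (H-adj-AA c d)) e)))
    BB≤ : ∑∑ H.BB ≤ ∑∑ H′.BB
    BB≤ = ∑-mono-≤ λ c → ∑-mono-≤ λ d → edgeIndicator-mono H H′ (B c) (B d)
            (λ e → G⊆H′ _ _ (trans (G-adj-BB c d) (trans (sym (H-adj-BB c d)) e)))
    BA≤ : ∑∑ H.BA ≤ ∑∑ H′.BA
    BA≤ = ∑-mono-≤ λ c → ∑-mono-≤ λ d → subst (_≤ H′.BA c d) (sym (H.BA≡0 c d)) z≤n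
    AB≤ : ∑∑ H.AB ≤ ∑∑ H′.AB
    AB≤ = ∑∑-≤-symmetrised H.AB H′.AB λ c d →
      subst₂ _≤_ (sym (cong₂ _+_ (trans (H.AB≡indicator c d) (cong indicator (H-adj-AB c d)))
                                 (trans (H.AB≡indicator d c) (cong indicator (H-adj-AB d c)))))
                 (sym (cong₂ _+_ (H′.AB≡indicator c d) (H′.AB≡indicator d c)))
                 (cross-pair-≤ H′ triangulation c d)

  G-treewidth : IsTreewidth G n
  G-treewidth = (restrict G⊆H pathDecomposition , pathDecomposition-width) , G-treewidth≥n

  H-treewidth : IsTreewidth H n
  H-treewidth = (pathDecomposition , pathDecomposition-width) , treewidthAtLeast-supergraph G⊆H G-treewidth≥n

  H-minimumTriangulation : IsMinimumTriangulation G H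
  H-minimumTriangulation = (H-chordal , G⊆H) , H-minimum

  triangulation-treewidth≥n : ∀ H′ s → IsTriangulation G H′ → IsTreewidth H′ s → n ≤ s
  triangulation-treewidth≥n H′ s (_ , G⊆H′) ((D , width≤s) , _) =
    treewidthAtLeast-supergraph G⊆H′ G-treewidth≥n s D width≤s

  τ≡0 : HasTau G 0
  τ≡0 = n , n , G-treewidth ,
        ((H , H-minimumTriangulation , H-treewidth) , λ H′ s minimum → triangulation-treewidth≥n H′ s (proj₁ minimum)) ,
        refl

mainTheorem4 : ∀ (n : ℕ) → 2 ≤ n → HasTau (Rook 2 n) 0
mainTheorem4 (suc t) _ = RookK₂.τ≡0 t
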